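{- Let $n\ge 1$ and $1\le j\le n$. Consider the ruler $[0,n]$ broken by repeated throws: at each throw, every current piece $[a,b]$ (integer endpoints) of length $b-a>1$ is broken into $[a,c]$ and $[c,b]$ with $c$ uniform on $\{a+1,\dots,b-1\}$, independently across pieces and throws; unit pieces are left alone. Let $\tau_{j,n}$ be the number of throws until the $j$-th unit stick $[j-1,j]$ is a piece on its own, and let $f_{j,n}(\rho)=\mathbb{E}[\rho^{\tau_{j,n}}]$. Then $$f_{j,n}(\rho)=\prod_{l=1}^{j-1}\Big(1+\frac{\rho-1}{l}\Big)\prod_{l'=1}^{n-j}\Big(1+\frac{\rho-1}{l'}\Big),$$ (empty products being $1$). In particular $f_{1,n}(\rho)=\prod_{l=1}^{n-1}\big(1+\frac{\rho-1}{l}\big)$.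
   Formalization: The argument ρ of the generating function $f_{j,n}(\rho)$ takes rational values. -}

module Defs where

open import Data.Nat as ℕ using (ℕ; zero; suc; _∸_; _≡ᵇ_)
open import Data.Integer using (+_)
open import Data.Rational using (ℚ; 0ℚ; 1ℚ; _+_; _*_; _-_; _/_)
open import Data.Bool using (_∧_)
open import Data.List using (List; []; _∷_; map; concatMap; length; [_]; _++_)
open import Data.Bool.ListAction using (any)
open import Data.Product using (_×_; _,_)

-- Finite discrete probability distributions: lists of (weight, outcome).
Dist : Set → Set
Dist A = List (ℚ × A)

pure : {A : Set} → A → Dist A
pure x = [ (1ℚ , x) ]

_>>=_ : {A B : Set} → Dist A → (A → Dist B) → Dist B
d >>= f = concatMap (λ { (p , x) → map (λ { (q , y) → (p * q , y) }) (f x) }) d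

expect : {A : Set} → Dist A → (A → ℚ) → ℚ
expect [] g = 0ℚ
expect ((p , x) ∷ d) g = p * g x + expect d g

-- Uniform distribution on a list of length suc k.
uniformSuc : {A : Set} (k : ℕ) → List A → Dist A
uniformSuc k xs = map (λ x → (+ 1 / suc k , x)) xs

Piece : Set
Piece = ℕ × ℕ

range : ℕ → ℕ → List ℕ
range a zero = []
range a (suc m) = suc a ∷ range (suc a) m

breakPiece : Piece → Dist (List Piece)
breakPiece (a , b) with b ∸ a
... | suc (suc k) = uniformSuc k (map (λ c → (a , c) ∷ (c , b) ∷ []) (range a (suc k)))
... | _ = pure ((a , b) ∷ [])

throw : List Piece → Dist (List Piece)
throw [] = pure []
throw (p ∷ ps) = breakPiece p >>= λ l → throw ps >>= λ r → pure (l ++ r)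

hasUnit : ℕ → List Piece → Data.Bool.Bool
hasUnit j = any (λ { (a , b) → (a ≡ᵇ j ∸ 1) ∧ (b ≡ᵇ j) })

-- truncPGF j ρ N s = E[ ρ ^ min(τ , N) ] where τ is the number of throws,
-- starting from configuration s, until [j-1,j] is a piece on its own.
truncPGF : ℕ → ℚ → ℕ → List Piece → ℚ
truncPGF j ρ N s with hasUnit j s
... | Data.Bool.true = 1ℚ
truncPGF j ρ zero s | Data.Bool.false = 1ℚ
truncPGF j ρ (suc N) s | Data.Bool.false = ρ * expect (throw s) (truncPGF j ρ N)

H : ℕ → ℚ → ℚ
H zero ρ = 1ℚ
H (suc m) ρ = H m ρ * (1ℚ + (ρ - 1ℚ) * (+ 1 / suc m))

-- Only the piece containing the unit stick matters. The other pieces avoid the stick,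
-- so do all their fragments, and since every throw is a probability distribution their
-- randomness integrates out. If that piece is [a , b] and the stick is [i , i + 1], the
-- truncated PGF is H (i - a) · H (b - i - 1), by induction on the number of throws: the
-- cut c is uniform on a < c < b, the piece kept is [c , b] for c ≤ i and [a , c]
-- otherwise, and with p = i - a, q = b - i - 1 the inductive values average to
-- (Σ_{l<p} H l · H q + H p · Σ_{l<q} H l) / (p + q); the identity
-- ρ · Σ_{l<p} H l = p · H p makes ρ times this average equal to H p · H q.

module Submission where

open import Defs
open import Data.Bool using (true; false; T; _∧_)
open import Data.Bool.Properties using (T-∧)
open import Data.Integer using (+_)
import Data.Integer.Solver as ℤ-Solver
open import Data.List using (List; []; _∷_; map; _++_; length; [_])
open import Data.List.Properties using (length-map)
open import Data.List.Membership.Propositional using (_∈_)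
open import Data.List.Relation.Unary.All as All using (All; []; _∷_)
open import Data.List.Relation.Unary.All.Properties using (++⁺; map⁺; All¬⇒¬Any)
open import Data.List.Relation.Unary.Any as Any using (here; there)
open import Data.List.Relation.Unary.Any.Properties using (any⁺; any⁻)
open import Data.Nat as ℕ using (ℕ; zero; suc; _≤_; _<_; _∸_; z≤n; s≤s; _≤?_)
import Data.Nat.Coprimality as Coprime
import Data.Nat.Properties as ℕₚ
open import Data.Nat.Tactic.RingSolver using (solve-∀)
open import Data.Product using (_×_; _,_; proj₂)
open import Data.Rational using (ℚ; 0ℚ; 1ℚ; _+_; _*_; _-_; _/_; 1/_)
open import Data.Rational.Literals using (fromℤ)
import Data.Rational.Properties as ℚₚ
open import Data.Rational.Solver using (module +-*-Solver)
open import Data.Rational.Unnormalised using (*≡*)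
import Data.Rational.Unnormalised.Properties as ℚᵘ
open import Data.Sum using (_⊎_; inj₁; inj₂)
open import Function using (_∘_; Equivalence)
open import Relation.Nullary using (¬_; yes; no; contradiction)
open import Relation.Binary.PropositionalEquality
  using (_≡_; refl; sym; trans; cong; cong₂; subst; module ≡-Reasoning)

-- Finite sums of rationals

fromℕ : ℕ → ℚ
fromℕ zero = 0ℚ
fromℕ (suc m) = 1ℚ + fromℕ m

fromℕ-+ : ∀ m n → fromℕ (m ℕ.+ n) ≡ fromℕ m + fromℕ n
fromℕ-+ zero n = sym (ℚₚ.+-identityˡ (fromℕ n))
fromℕ-+ (suc m) n =
  trans (cong (λ z → 1ℚ + z) (fromℕ-+ m n)) (sym (ℚₚ.+-assoc 1ℚ (fromℕ m) (fromℕ n)))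

1+fromℤ : ∀ m → 1ℚ + fromℤ (+ m) ≡ fromℤ (+ suc m)
1+fromℤ m = ℚₚ.toℚᵘ-injective
  (ℚᵘ.≃-trans (ℚₚ.toℚᵘ-homo-+ 1ℚ (fromℤ (+ m))) (*≡* (commute (+ m))))
  where
  open ℤ-Solver.+-*-Solver
  commute = solve 1 (λ x → (con (+ 1) :* con (+ 1) :+ x :* con (+ 1)) :* con (+ 1)
                         := (con (+ 1) :+ x) :* (con (+ 1) :* con (+ 1))) refl

fromℕ≡fromℤ : ∀ m → fromℕ m ≡ fromℤ (+ m)
fromℕ≡fromℤ zero = refl
fromℕ≡fromℤ (suc m) = trans (cong (λ z → 1ℚ + z) (fromℕ≡fromℤ m)) (1+fromℤ m)

1/suc-inverseˡ : ∀ k → (+ 1 / suc k) * fromℕ (suc k) ≡ 1ℚ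
1/suc-inverseˡ k = begin
  (+ 1 / suc k) * fromℕ (suc k)             ≡⟨ cong₂ _*_ 1/suc≡ (fromℕ≡fromℤ (suc k)) ⟩
  1/ fromℤ (+ suc k) * fromℤ (+ suc k)      ≡⟨ ℚₚ.*-inverseˡ (fromℤ (+ suc k)) ⟩
  1ℚ                                        ∎
  where
  open ≡-Reasoning
  1/suc≡ : + 1 / suc k ≡ 1/ fromℤ (+ suc k)
  1/suc≡ = ℚₚ.normalize-coprime (Coprime.1-coprimeTo (suc k))

∑ : {A : Set} → List A → (A → ℚ) → ℚ
∑ [] f = 0ℚ
∑ (x ∷ xs) f = f x + ∑ xs f

∑< : ℕ → (ℕ → ℚ) → ℚ
∑< zero f = 0ℚ
∑< (suc n) f = f n + ∑< n f

∑-++ : ∀ {A : Set} (xs ys : List A) (f : A → ℚ) → ∑ (xs ++ ys) f ≡ ∑ xs f + ∑ ys f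
∑-++ [] ys f = sym (ℚₚ.+-identityˡ (∑ ys f))
∑-++ (x ∷ xs) ys f =
  trans (cong (λ z → f x + z) (∑-++ xs ys f)) (sym (ℚₚ.+-assoc (f x) (∑ xs f) (∑ ys f)))

∑-map : ∀ {A B : Set} (g : A → B) (xs : List A) (f : B → ℚ) → ∑ (map g xs) f ≡ ∑ xs (f ∘ g)
∑-map g [] f = refl
∑-map g (x ∷ xs) f = cong (λ z → f (g x) + z) (∑-map g xs f)

∑-cong : ∀ {A : Set} {P : A → Set} {xs : List A} {f g : A → ℚ} →
         All P xs → (∀ {x} → P x → f x ≡ g x) → ∑ xs f ≡ ∑ xs g
∑-cong [] f≡g = refl
∑-cong (px ∷ pxs) f≡g = cong₂ _+_ (f≡g px) (∑-cong pxs f≡g)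

∑-*ˡ : ∀ {A : Set} (c : ℚ) (xs : List A) (f : A → ℚ) → ∑ xs (λ x → c * f x) ≡ c * ∑ xs f
∑-*ˡ c [] f = sym (ℚₚ.*-zeroʳ c)
∑-*ˡ c (x ∷ xs) f =
  trans (cong (λ z → c * f x + z) (∑-*ˡ c xs f)) (sym (ℚₚ.*-distribˡ-+ c (f x) (∑ xs f)))

∑-*ʳ : ∀ {A : Set} (c : ℚ) (xs : List A) (f : A → ℚ) → ∑ xs (λ x → f x * c) ≡ ∑ xs f * c
∑-*ʳ c [] f = sym (ℚₚ.*-zeroˡ c)
∑-*ʳ c (x ∷ xs) f =
  trans (cong (λ z → f x * c + z) (∑-*ʳ c xs f)) (sym (ℚₚ.*-distribʳ-+ c (f x) (∑ xs f)))

∑-1 : ∀ {A : Set} (xs : List A) → ∑ xs (λ _ → 1ℚ) ≡ fromℕ (length xs)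
∑-1 [] = refl
∑-1 (x ∷ xs) = cong (λ z → 1ℚ + z) (∑-1 xs)

length-range : ∀ a m → length (range a m) ≡ m
length-range a zero = refl
length-range a (suc m) = cong suc (length-range (suc a) m)

range-++ : ∀ a m n → range a (m ℕ.+ n) ≡ range a m ++ range (m ℕ.+ a) n
range-++ a zero n = refl
range-++ a (suc m) n = cong (suc a ∷_)
  (trans (range-++ (suc a) m n) (cong (λ x → range (suc a) m ++ range x n) (ℕₚ.+-suc m a)))

range-snoc : ∀ a m → range a (suc m) ≡ range a m ++ [ suc (m ℕ.+ a) ]
range-snoc a m = trans (cong (range a) (ℕₚ.+-comm 1 m)) (range-++ a m 1)

range-bounds : ∀ a m → All (λ c → a < c × c ≤ m ℕ.+ a) (range a m)
range-bounds a zero = []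
range-bounds a (suc m) =
  (ℕₚ.n<1+n a , s≤s (ℕₚ.m≤n+m a m)) ∷ All.map weaken (range-bounds (suc a) m)
  where
  weaken : ∀ {c} → suc a < c × c ≤ m ℕ.+ suc a → a < c × c ≤ suc m ℕ.+ a
  weaken {c} (a+1<c , c≤) = ℕₚ.<⇒≤ a+1<c , subst (λ x → c ≤ x) (ℕₚ.+-suc m a) c≤

∑-range-reflect : ∀ (f : ℕ → ℚ) a p → ∑ (range a p) (λ c → f (p ℕ.+ a ∸ c)) ≡ ∑< p f
∑-range-reflect f a zero = refl
∑-range-reflect f a (suc p) = cong₂ _+_ (cong f (ℕₚ.m+n∸n≡m p a))
  (trans (cong (λ x → ∑ (range (suc a) p) (λ c → f (x ∸ c))) (sym (ℕₚ.+-suc p a)))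
         (∑-range-reflect f (suc a) p))

∑-range-shift : ∀ (f : ℕ → ℚ) x q → ∑ (range x q) (λ c → f (c ∸ suc x)) ≡ ∑< q f
∑-range-shift f x zero = refl
∑-range-shift f x (suc q) = begin
  ∑ (range x (suc q)) g                   ≡⟨ cong (λ r → ∑ r g) (range-snoc x q) ⟩
  ∑ (range x q ++ [ suc (q ℕ.+ x) ]) g    ≡⟨ ∑-++ (range x q) _ g ⟩
  ∑ (range x q) g + (f (q ℕ.+ x ∸ x) + 0ℚ)
    ≡⟨ cong₂ _+_ (∑-range-shift f x q) (trans (ℚₚ.+-identityʳ _) (cong f (ℕₚ.m+n∸n≡m q x))) ⟩
  ∑< q f + f q                            ≡⟨ ℚₚ.+-comm (∑< q f) (f q) ⟩
  f q + ∑< q f                            ∎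
  where
  open ≡-Reasoning
  g = λ c → f (c ∸ suc x)

H-suc : ∀ p ρ → fromℕ (suc p) * H (suc p) ρ ≡ (fromℕ p + ρ) * H p ρ
H-suc p ρ = begin
  (1ℚ + x) * (h * (1ℚ + (ρ - 1ℚ) * w))
    ≡⟨ solve 4 (λ x h r w → (con 1ℚ :+ x) :* (h :* (con 1ℚ :+ (r :- con 1ℚ) :* w))
                          := (con 1ℚ :+ x) :* h :+ (r :- con 1ℚ) :* h :* (w :* (con 1ℚ :+ x)))
               refl x h ρ w ⟩
  (1ℚ + x) * h + (ρ - 1ℚ) * h * (w * (1ℚ + x))
    ≡⟨ cong (λ z → (1ℚ + x) * h + (ρ - 1ℚ) * h * z) (1/suc-inverseˡ p) ⟩
  (1ℚ + x) * h + (ρ - 1ℚ) * h * 1ℚ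
    ≡⟨ solve 3 (λ x h r → (con 1ℚ :+ x) :* h :+ (r :- con 1ℚ) :* h :* con 1ℚ := (x :+ r) :* h)
               refl x h ρ ⟩
  (x + ρ) * h ∎
  where
  open ≡-Reasoning
  open +-*-Solver
  x = fromℕ p
  h = H p ρ
  w = + 1 / suc p

ρ*∑<H : ∀ p ρ → ρ * ∑< p (λ l → H l ρ) ≡ fromℕ p * H p ρ
ρ*∑<H zero ρ = ℚₚ.*-zeroʳ ρ
ρ*∑<H (suc p) ρ = begin
  ρ * (H p ρ + ∑< p (λ l → H l ρ))        ≡⟨ ℚₚ.*-distribˡ-+ ρ (H p ρ) _ ⟩
  ρ * H p ρ + ρ * ∑< p (λ l → H l ρ)      ≡⟨ cong (λ z → ρ * H p ρ + z) (ρ*∑<H p ρ) ⟩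
  ρ * H p ρ + fromℕ p * H p ρ             ≡⟨ solve 3 (λ r h x → r :* h :+ x :* h := (x :+ r) :* h)
                                                      refl ρ (H p ρ) (fromℕ p) ⟩
  (fromℕ p + ρ) * H p ρ                   ≡⟨ H-suc p ρ ⟨
  fromℕ (suc p) * H (suc p) ρ             ∎
  where
  open ≡-Reasoning
  open +-*-Solver

H*H-cut-recurrence : ∀ ρ p q k → suc k ≡ p ℕ.+ q →
  ρ * ((+ 1 / suc k) * (∑< p (λ l → H l ρ) * H q ρ + H p ρ * ∑< q (λ l → H l ρ)))
    ≡ H p ρ * H q ρ
H*H-cut-recurrence ρ p q k k+1≡p+q = begin
  ρ * (w * (Sp * H q ρ + H p ρ * Sq))
    ≡⟨ solve 6 (λ r w sp hq hp sq → r :* (w :* (sp :* hq :+ hp :* sq))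
                                  := w :* ((r :* sp) :* hq :+ hp :* (r :* sq)))
               refl ρ w Sp (H q ρ) (H p ρ) Sq ⟩
  w * ((ρ * Sp) * H q ρ + H p ρ * (ρ * Sq))
    ≡⟨ cong₂ (λ u v → w * (u * H q ρ + H p ρ * v)) (ρ*∑<H p ρ) (ρ*∑<H q ρ) ⟩
  w * ((fromℕ p * H p ρ) * H q ρ + H p ρ * (fromℕ q * H q ρ))
    ≡⟨ solve 5 (λ w x hp hq y → w :* ((x :* hp) :* hq :+ hp :* (y :* hq))
                              := (w :* (x :+ y)) :* (hp :* hq))
               refl w (fromℕ p) (H p ρ) (H q ρ) (fromℕ q) ⟩
  (w * (fromℕ p + fromℕ q)) * (H p ρ * H q ρ)
    ≡⟨ cong (λ z → (w * z) * (H p ρ * H q ρ)) p+q≡k+1 ⟩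
  (w * fromℕ (suc k)) * (H p ρ * H q ρ)
    ≡⟨ cong (_* (H p ρ * H q ρ)) (1/suc-inverseˡ k) ⟩
  1ℚ * (H p ρ * H q ρ)
    ≡⟨ ℚₚ.*-identityˡ _ ⟩
  H p ρ * H q ρ ∎
  where
  open ≡-Reasoning
  open +-*-Solver
  w = + 1 / suc k
  Sp = ∑< p (λ l → H l ρ)
  Sq = ∑< q (λ l → H l ρ)
  p+q≡k+1 : fromℕ p + fromℕ q ≡ fromℕ (suc k)
  p+q≡k+1 = trans (sym (fromℕ-+ p q)) (cong fromℕ (sym k+1≡p+q))

-- Finite distributions

AllOutcomes : {A : Set} → (A → Set) → Dist A → Set
AllOutcomes P = All (P ∘ proj₂)

mass : {A : Set} → Dist A → ℚ
mass d = expect d (λ _ → 1ℚ)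

scale : {A : Set} → ℚ → ℚ × A → ℚ × A
scale p (q , x) = (p * q , x)

expect-++ : ∀ {A : Set} (d e : Dist A) (g : A → ℚ) → expect (d ++ e) g ≡ expect d g + expect e g
expect-++ [] e g = sym (ℚₚ.+-identityˡ (expect e g))
expect-++ ((p , x) ∷ d) e g =
  trans (cong (λ z → p * g x + z) (expect-++ d e g)) (sym (ℚₚ.+-assoc (p * g x) _ _))

expect-scale : ∀ {A : Set} (p : ℚ) (d : Dist A) (g : A → ℚ) →
               expect (map (scale p) d) g ≡ p * expect d g
expect-scale p [] g = sym (ℚₚ.*-zeroʳ p)
expect-scale p ((q , x) ∷ d) g =
  trans (cong₂ _+_ (ℚₚ.*-assoc p q (g x)) (expect-scale p d g))
        (sym (ℚₚ.*-distribˡ-+ p (q * g x) (expect d g)))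

expect-bind : ∀ {A B : Set} (d : Dist A) (f : A → Dist B) (g : B → ℚ) →
              expect (d >>= f) g ≡ expect d (λ x → expect (f x) g)
expect-bind [] f g = refl
expect-bind ((p , x) ∷ d) f g =
  trans (expect-++ (map (scale p) (f x)) (d >>= f) g)
        (cong₂ _+_ (expect-scale p (f x) g) (expect-bind d f g))

expect-pure : ∀ {A : Set} (x : A) (g : A → ℚ) → expect (pure x) g ≡ g x
expect-pure x g = trans (ℚₚ.+-identityʳ (1ℚ * g x)) (ℚₚ.*-identityˡ (g x))

expect-cong : ∀ {A : Set} (d : Dist A) {g h : A → ℚ} → (∀ x → g x ≡ h x) → expect d g ≡ expect d h
expect-cong [] g≡h = refl
expect-cong ((p , x) ∷ d) g≡h = cong₂ _+_ (cong (p *_) (g≡h x)) (expect-cong d g≡h)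

expect-const-on : ∀ {A : Set} {P : A → Set} {d : Dist A} {g : A → ℚ} {c : ℚ} →
  AllOutcomes P d → (∀ {x} → P x → g x ≡ c) → expect d g ≡ mass d * c
expect-const-on {c = c} [] g≡c = sym (ℚₚ.*-zeroˡ c)
expect-const-on {d = (p , x) ∷ d} {g} {c} (px ∷ pd) g≡c = begin
  p * g x + expect d g        ≡⟨ cong₂ (λ u v → p * u + v) (g≡c px) (expect-const-on pd g≡c) ⟩
  p * c + mass d * c          ≡⟨ solve 3 (λ p c m → p :* c :+ m :* c := (p :* con 1ℚ :+ m) :* c)
                                         refl p c (mass d) ⟩
  (p * 1ℚ + mass d) * c       ∎
  where
  open ≡-Reasoning
  open +-*-Solver

expect-const-on-prob : ∀ {A : Set} {P : A → Set} {d : Dist A} {g : A → ℚ} {c : ℚ} →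
  mass d ≡ 1ℚ → AllOutcomes P d → (∀ {x} → P x → g x ≡ c) → expect d g ≡ c
expect-const-on-prob {c = c} mass≡1 pd g≡c =
  trans (expect-const-on pd g≡c) (trans (cong (_* c) mass≡1) (ℚₚ.*-identityˡ c))

AllOutcomes-bind : ∀ {A B : Set} {P : A → Set} {Q : B → Set} {d : Dist A} {f : A → Dist B} →
  AllOutcomes P d → (∀ {x} → P x → AllOutcomes Q (f x)) → AllOutcomes Q (d >>= f)
AllOutcomes-bind [] pf = []
AllOutcomes-bind (px ∷ pd) pf = ++⁺ (map⁺ (pf px)) (AllOutcomes-bind pd pf)

expect-uniformSuc : ∀ {A : Set} k (xs : List A) (g : A → ℚ) →
  expect (uniformSuc k xs) g ≡ (+ 1 / suc k) * ∑ xs g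
expect-uniformSuc k [] g = sym (ℚₚ.*-zeroʳ (+ 1 / suc k))
expect-uniformSuc k (x ∷ xs) g =
  trans (cong (λ z → (+ 1 / suc k) * g x + z) (expect-uniformSuc k xs g))
        (sym (ℚₚ.*-distribˡ-+ (+ 1 / suc k) (g x) (∑ xs g)))

mass-uniformSuc : ∀ {A : Set} k (xs : List A) → length xs ≡ suc k → mass (uniformSuc k xs) ≡ 1ℚ
mass-uniformSuc k xs len≡ = begin
  mass (uniformSuc k xs)                 ≡⟨ expect-uniformSuc k xs _ ⟩
  (+ 1 / suc k) * ∑ xs (λ _ → 1ℚ)        ≡⟨ cong ((+ 1 / suc k) *_) (∑-1 xs) ⟩
  (+ 1 / suc k) * fromℕ (length xs)      ≡⟨ cong (λ n → (+ 1 / suc k) * fromℕ n) len≡ ⟩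
  (+ 1 / suc k) * fromℕ (suc k)          ≡⟨ 1/suc-inverseˡ k ⟩
  1ℚ                                     ∎
  where open ≡-Reasoning

-- Pieces relative to the unit stick [i , i + 1], the paper's (i + 1)-th stick

Avoids : ℕ → Piece → Set
Avoids i (x , y) = y ≤ i ⊎ suc i ≤ x

Covers : ℕ → Piece → Set
Covers i (x , y) = x ≤ i × i < y

width : Piece → ℕ
width (x , y) = y ∸ x

data AvoidExcept (i : ℕ) (t : Piece) : List Piece → Set where
  here  : ∀ {s} → All (Avoids i) s → AvoidExcept i t (t ∷ s)
  there : ∀ {u s} → Avoids i u → AvoidExcept i t s → AvoidExcept i t (u ∷ s)

AvoidExcept-++ : ∀ {i t s} {l : List Piece} → All (Avoids i) l → AvoidExcept i t s →
                 AvoidExcept i t (l ++ s)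
AvoidExcept-++ [] ex = ex
AvoidExcept-++ (av ∷ avs) ex = there av (AvoidExcept-++ avs ex)

AvoidExcept⇒∈ : ∀ {i t s} → AvoidExcept i t s → t ∈ s
AvoidExcept⇒∈ (here _) = here refl
AvoidExcept⇒∈ (there _ ex) = there (AvoidExcept⇒∈ ex)

AvoidExcept⇒All : ∀ {i t s} {P : Piece → Set} → AvoidExcept i t s → P t →
                  (∀ {u} → Avoids i u → P u) → All P s
AvoidExcept⇒All (here avs) pt pav = pt ∷ All.map pav avs
AvoidExcept⇒All (there av ex) pt pav = pav av ∷ AvoidExcept⇒All ex pt pav

cut : ℕ → ℕ → ℕ → List Piece
cut a b c = (a , c) ∷ (c , b) ∷ []

cut-avoids : ∀ {i x y c} → Avoids i (x , y) → x < c → c < y → All (Avoids i) (cut x y c)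
cut-avoids (inj₁ y≤i) x<c c<y = inj₁ (ℕₚ.≤-trans (ℕₚ.<⇒≤ c<y) y≤i) ∷ inj₁ y≤i ∷ []
cut-avoids (inj₂ i<x) x<c c<y = inj₂ i<x ∷ inj₂ (ℕₚ.≤-trans i<x (ℕₚ.<⇒≤ x<c)) ∷ []

m∸n≡1+o⇒m≡1+o+n : ∀ {m n o} → m ∸ n ≡ suc o → m ≡ suc o ℕ.+ n
m∸n≡1+o⇒m≡1+o+n {m} {zero} m≡1+o = trans m≡1+o (sym (ℕₚ.+-identityʳ _))
m∸n≡1+o⇒m≡1+o+n {suc m} {suc n} {o} m∸n≡1+o =
  trans (cong suc (m∸n≡1+o⇒m≡1+o+n m∸n≡1+o)) (sym (ℕₚ.+-suc (suc o) n))

cut-points : ∀ {a b k} → b ∸ a ≡ suc (suc k) → All (λ c → a < c × c < b) (range a (suc k))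
cut-points {a} {b} {k} width≡ = All.map inside (range-bounds a (suc k))
  where
  inside : ∀ {c} → a < c × c ≤ suc k ℕ.+ a → a < c × c < b
  inside (a<c , c≤) = a<c , subst (_ <_) (sym (m∸n≡1+o⇒m≡1+o+n width≡)) (s≤s c≤)

breakPiece-wide : ∀ {a b k} → b ∸ a ≡ suc (suc k) →
  breakPiece (a , b) ≡ uniformSuc k (map (cut a b) (range a (suc k)))
breakPiece-wide {a} {b} width≡ with b ∸ a
breakPiece-wide refl | ._ = refl

mass-breakPiece : ∀ t → mass (breakPiece t) ≡ 1ℚ
mass-breakPiece (x , y) with y ∸ x
... | zero = refl
... | suc zero = refl
... | suc (suc k) = mass-uniformSuc k (map (cut x y) (range x (suc k)))
  (trans (length-map (cut x y) (range x (suc k))) (length-range x (suc k)))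

AllOutcomes-breakPiece : ∀ {i} t → Avoids i t → AllOutcomes (All (Avoids i)) (breakPiece t)
AllOutcomes-breakPiece (x , y) av with y ∸ x in width≡
... | zero = (av ∷ []) ∷ []
... | suc zero = (av ∷ []) ∷ []
... | suc (suc k) = map⁺
  (map⁺ (All.map (λ (x<c , c<y) → cut-avoids av x<c c<y) (cut-points width≡)))

expect-throw-∷ : ∀ u s (g : List Piece → ℚ) →
  expect (throw (u ∷ s)) g ≡ expect (breakPiece u) (λ l → expect (throw s) (λ r → g (l ++ r)))
expect-throw-∷ u s g =
  trans (expect-bind (breakPiece u) _ g)
        (expect-cong (breakPiece u) λ l →
          trans (expect-bind (throw s) (λ r → pure (l ++ r)) g)
                (expect-cong (throw s) λ r → expect-pure (l ++ r) g))

mass-throw : ∀ s → mass (throw s) ≡ 1ℚ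
mass-throw [] = refl
mass-throw (u ∷ s) =
  trans (expect-throw-∷ u s _)
        (trans (expect-cong (breakPiece u) (λ _ → mass-throw s)) (mass-breakPiece u))

AllOutcomes-throw : ∀ {i} s → All (Avoids i) s → AllOutcomes (All (Avoids i)) (throw s)
AllOutcomes-throw [] [] = [] ∷ []
AllOutcomes-throw (u ∷ s) (av ∷ avs) =
  AllOutcomes-bind (AllOutcomes-breakPiece u av)
    (λ avl → AllOutcomes-bind (AllOutcomes-throw s avs) (λ avr → ++⁺ avl avr ∷ []))

expect-throw-avoiding : ∀ {i s} {g : List Piece → ℚ} {c : ℚ} → All (Avoids i) s →
  (∀ {r} → All (Avoids i) r → g r ≡ c) → expect (throw s) g ≡ c
expect-throw-avoiding {s = s} avs = expect-const-on-prob (mass-throw s) (AllOutcomes-throw s avs)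

expect-breakPiece-avoiding : ∀ {i u} {g : List Piece → ℚ} {c : ℚ} → Avoids i u →
  (∀ {l} → All (Avoids i) l → g l ≡ c) → expect (breakPiece u) g ≡ c
expect-breakPiece-avoiding {u = u} av =
  expect-const-on-prob (mass-breakPiece u) (AllOutcomes-breakPiece u av)

coveringHalf : ℕ → Piece → ℕ → Piece
coveringHalf i (a , b) c with c ≤? i
... | yes _ = (c , b)
... | no  _ = (a , c)

coveringHalf-≤ : ∀ {i a b c} → c ≤ i → coveringHalf i (a , b) c ≡ (c , b)
coveringHalf-≤ {i} {c = c} c≤i with c ≤? i
... | yes _ = refl
... | no c≰i = contradiction c≤i c≰i

coveringHalf-> : ∀ {i a b c} → i < c → coveringHalf i (a , b) c ≡ (a , c)
coveringHalf-> {i} {c = c} i<c with c ≤? i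
... | yes c≤i = contradiction c≤i (ℕₚ.<⇒≱ i<c)
... | no _ = refl

AvoidExcept-cut : ∀ {i a b c r} → All (Avoids i) r →
                  AvoidExcept i (coveringHalf i (a , b) c) (cut a b c ++ r)
AvoidExcept-cut {i} {c = c} avr with c ≤? i
... | yes c≤i = there (inj₁ c≤i) (here avr)
... | no c≰i = here (inj₂ (ℕₚ.≰⇒> c≰i) ∷ avr)

coveringHalf-covers : ∀ {i a b c} → Covers i (a , b) → a < c → c < b →
                      Covers i (coveringHalf i (a , b) c)
coveringHalf-covers {i} {c = c} (a≤i , i<b) a<c c<b with c ≤? i
... | yes c≤i = c≤i , i<b
... | no c≰i = a≤i , ℕₚ.≰⇒> c≰i

coveringHalf-narrower : ∀ {i a b c} → a < c → c < b → width (coveringHalf i (a , b) c) < b ∸ a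
coveringHalf-narrower {i} {a} {b} {c} a<c c<b with c ≤? i
... | yes _ = ℕₚ.∸-monoʳ-< a<c (ℕₚ.<⇒≤ c<b)
... | no _ = ℕₚ.∸-monoˡ-< c<b (ℕₚ.<⇒≤ a<c)

expect-throw-AvoidExcept : ∀ {i a b k s} {g : List Piece → ℚ} (G : ℕ → ℚ) →
  b ∸ a ≡ suc (suc k) → AvoidExcept i (a , b) s →
  (∀ {c r} → a < c → c < b → AvoidExcept i (coveringHalf i (a , b) c) r → g r ≡ G c) →
  expect (throw s) g ≡ (+ 1 / suc k) * ∑ (range a (suc k)) G
expect-throw-AvoidExcept {a = a} {b} {k} {g = g} G width≡ (here {R} avR) value = begin
  expect (throw ((a , b) ∷ R)) g
    ≡⟨ expect-throw-∷ (a , b) R g ⟩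
  expect (breakPiece (a , b)) F
    ≡⟨ cong (λ d → expect d F) (breakPiece-wide width≡) ⟩
  expect (uniformSuc k (map (cut a b) (range a (suc k)))) F
    ≡⟨ expect-uniformSuc k (map (cut a b) (range a (suc k))) F ⟩
  (+ 1 / suc k) * ∑ (map (cut a b) (range a (suc k))) F
    ≡⟨ cong ((+ 1 / suc k) *_) (∑-map (cut a b) (range a (suc k)) F) ⟩
  (+ 1 / suc k) * ∑ (range a (suc k)) (F ∘ cut a b)
    ≡⟨ cong ((+ 1 / suc k) *_) (∑-cong (cut-points width≡) F∘cut≡G) ⟩
  (+ 1 / suc k) * ∑ (range a (suc k)) G ∎
  where
  open ≡-Reasoning
  F : List Piece → ℚ
  F l = expect (throw R) (λ r → g (l ++ r))
  F∘cut≡G : ∀ {c} → a < c × c < b → F (cut a b c) ≡ G c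
  F∘cut≡G (a<c , c<b) = expect-throw-avoiding avR (λ avr → value a<c c<b (AvoidExcept-cut avr))
expect-throw-AvoidExcept {g = g} G width≡ (there {u} {s} av ex) value =
  trans (expect-throw-∷ u s g)
        (expect-breakPiece-avoiding av λ avl →
          expect-throw-AvoidExcept G width≡ ex λ a<c c<b ex' →
            value a<c c<b (AvoidExcept-++ avl ex'))

truncPGF-found : ∀ j ρ N s → T (hasUnit j s) → truncPGF j ρ N s ≡ 1ℚ
truncPGF-found j ρ N s found with hasUnit j s
... | true = refl

truncPGF-step : ∀ j ρ N s → ¬ T (hasUnit j s) →
  truncPGF j ρ (suc N) s ≡ ρ * expect (throw s) (truncPGF j ρ N)
truncPGF-step j ρ N s absent with hasUnit j s
... | true = contradiction _ absent
... | false = refl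

unit-test-sound : ∀ {i x y} → T ((x ℕ.≡ᵇ i) ∧ (y ℕ.≡ᵇ suc i)) → (x , y) ≡ (i , suc i)
unit-test-sound {i} {x} {y} test with Equivalence.to T-∧ test
... | x≡ᵇi , y≡ᵇi+1 = cong₂ _,_ (ℕₚ.≡ᵇ⇒≡ x i x≡ᵇi) (ℕₚ.≡ᵇ⇒≡ y (suc i) y≡ᵇi+1)

unit-found : ∀ {i s} → AvoidExcept i (i , suc i) s → T (hasUnit (suc i) s)
unit-found {i} ex = any⁺ _ (Any.map (λ { refl → test }) (AvoidExcept⇒∈ ex))
  where
  test : T ((i ℕ.≡ᵇ i) ∧ (suc i ℕ.≡ᵇ suc i))
  test = Equivalence.from T-∧ (ℕₚ.≡⇒≡ᵇ i i refl , ℕₚ.≡⇒≡ᵇ i i refl)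

unit-absent : ∀ {i t s} → AvoidExcept i t s → 2 ≤ width t → ¬ T (hasUnit (suc i) s)
unit-absent {i} {t} {s} ex wide found =
  All¬⇒¬Any (AvoidExcept⇒All ex notUnit-wide notUnit-avoids)
            (Any.map unit-test-sound (any⁻ _ s found))
  where
  notUnit-wide : ¬ t ≡ (i , suc i)
  notUnit-wide refl = contradiction (subst (2 ≤_) (ℕₚ.m+n∸n≡m 1 i) wide) λ { (s≤s ()) }
  notUnit-avoids : ∀ {u} → Avoids i u → ¬ u ≡ (i , suc i)
  notUnit-avoids (inj₁ i+1≤i) refl = ℕₚ.1+n≰n i+1≤i
  notUnit-avoids (inj₂ i+1≤i) refl = ℕₚ.1+n≰n i+1≤i

-- The value f_{i-a+1, b-a} of the theorem: as long as all other pieces avoid the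
-- stick, the configuration evolves like the ruler [a , b] on its own.
coverPGF : ℕ → ℚ → Piece → ℚ
coverPGF i ρ (a , b) = H (i ∸ a) ρ * H (b ∸ suc i) ρ

∑-coverPGF-halves : ∀ ρ p q a →
  let i = p ℕ.+ a ; b = q ℕ.+ suc i in
  ∑ (range a (p ℕ.+ q)) (coverPGF i ρ ∘ coveringHalf i (a , b))
    ≡ ∑< p (λ l → H l ρ) * H q ρ + H p ρ * ∑< q (λ l → H l ρ)
∑-coverPGF-halves ρ p q a = begin
  ∑ (range a (p ℕ.+ q)) F                    ≡⟨ cong (λ r → ∑ r F) (range-++ a p q) ⟩
  ∑ (range a p ++ range i q) F               ≡⟨ ∑-++ (range a p) (range i q) F ⟩
  ∑ (range a p) F + ∑ (range i q) F          ≡⟨ cong₂ _+_ left right ⟩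
  ∑< p (λ l → H l ρ) * H q ρ + H p ρ * ∑< q (λ l → H l ρ) ∎
  where
  open ≡-Reasoning
  i = p ℕ.+ a
  b = q ℕ.+ suc i
  F = coverPGF i ρ ∘ coveringHalf i (a , b)
  left : ∑ (range a p) F ≡ ∑< p (λ l → H l ρ) * H q ρ
  left = begin
    ∑ (range a p) F
      ≡⟨ ∑-cong (range-bounds a p) (λ {c} (_ , c≤i) →
           trans (cong (coverPGF i ρ) (coveringHalf-≤ c≤i))
                 (cong (λ n → H (i ∸ c) ρ * H n ρ) (ℕₚ.m+n∸n≡m q (suc i)))) ⟩
    ∑ (range a p) (λ c → H (i ∸ c) ρ * H q ρ)
      ≡⟨ ∑-*ʳ (H q ρ) (range a p) _ ⟩
    ∑ (range a p) (λ c → H (i ∸ c) ρ) * H q ρ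
      ≡⟨ cong (_* H q ρ) (∑-range-reflect (λ l → H l ρ) a p) ⟩
    ∑< p (λ l → H l ρ) * H q ρ ∎
  right : ∑ (range i q) F ≡ H p ρ * ∑< q (λ l → H l ρ)
  right = begin
    ∑ (range i q) F
      ≡⟨ ∑-cong (range-bounds i q) (λ {c} (i<c , _) →
           trans (cong (coverPGF i ρ) (coveringHalf-> i<c))
                 (cong (λ m → H m ρ * H (c ∸ suc i) ρ) (ℕₚ.m+n∸n≡m p a))) ⟩
    ∑ (range i q) (λ c → H p ρ * H (c ∸ suc i) ρ)
      ≡⟨ ∑-*ˡ (H p ρ) (range i q) _ ⟩
    H p ρ * ∑ (range i q) (λ c → H (c ∸ suc i) ρ)
      ≡⟨ cong (H p ρ *_) (∑-range-shift (λ l → H l ρ) i q) ⟩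
    H p ρ * ∑< q (λ l → H l ρ) ∎

+-shuffle : ∀ q p a → q ℕ.+ suc (p ℕ.+ a) ≡ suc (p ℕ.+ q) ℕ.+ a
+-shuffle = solve-∀

width-split : ∀ p q a {k} → suc k ≡ p ℕ.+ q → q ℕ.+ suc (p ℕ.+ a) ∸ a ≡ suc (suc k)
width-split p q a {k} k+1≡p+q = begin
  q ℕ.+ suc (p ℕ.+ a) ∸ a     ≡⟨ cong (_∸ a) (+-shuffle q p a) ⟩
  suc (p ℕ.+ q) ℕ.+ a ∸ a     ≡⟨ ℕₚ.m+n∸n≡m (suc (p ℕ.+ q)) a ⟩
  suc (p ℕ.+ q)               ≡⟨ cong suc k+1≡p+q ⟨
  suc (suc k)                 ∎
  where open ≡-Reasoning

PGFClaim : ℚ → ℕ → ℕ → Set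
PGFClaim ρ N i = ∀ {t s} → AvoidExcept i t s → Covers i t → width t ≤ suc N →
                 truncPGF (suc i) ρ N s ≡ coverPGF i ρ t

truncPGF-cover : ∀ ρ N i → PGFClaim ρ N i
truncPGF-split : ∀ ρ N p q a {s} → AvoidExcept (p ℕ.+ a) (a , q ℕ.+ suc (p ℕ.+ a)) s →
  q ℕ.+ suc (p ℕ.+ a) ∸ a ≤ suc N → truncPGF (suc (p ℕ.+ a)) ρ N s ≡ H p ρ * H q ρ
truncPGF-wide : ∀ ρ N p q a k {s} → suc k ≡ p ℕ.+ q →
  AvoidExcept (p ℕ.+ a) (a , q ℕ.+ suc (p ℕ.+ a)) s →
  q ℕ.+ suc (p ℕ.+ a) ∸ a ≤ suc N → truncPGF (suc (p ℕ.+ a)) ρ N s ≡ H p ρ * H q ρ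

-- Abstracting i ∸ a and b ∸ suc i also turns the goal's coverPGF into H p ρ * H q ρ.
truncPGF-cover ρ N i {a , b} ex (a≤i , i<b) bound
  with i ∸ a | ℕₚ.m∸n+n≡m a≤i | b ∸ suc i | ℕₚ.m∸n+n≡m i<b
... | p | refl | q | refl = truncPGF-split ρ N p q a ex bound

truncPGF-split ρ N zero zero a {s} ex bound =
  trans (truncPGF-found (suc a) ρ N s (unit-found ex)) (sym (ℚₚ.*-identityˡ 1ℚ))
truncPGF-split ρ N (suc p) q a ex bound = truncPGF-wide ρ N (suc p) q a (p ℕ.+ q) refl ex bound
truncPGF-split ρ N zero (suc q) a ex bound = truncPGF-wide ρ N zero (suc q) a q refl ex bound

truncPGF-wide ρ zero p q a k k+1≡p+q ex bound =
  contradiction (subst (_≤ 1) (width-split p q a k+1≡p+q) bound) λ { (s≤s ()) }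
truncPGF-wide ρ (suc N) p q a k {s} k+1≡p+q ex bound = begin
  truncPGF (suc i) ρ (suc N) s
    ≡⟨ truncPGF-step (suc i) ρ N s (unit-absent ex (subst (2 ≤_) (sym width≡) (s≤s (s≤s z≤n)))) ⟩
  ρ * expect (throw s) (truncPGF (suc i) ρ N)
    ≡⟨ cong (ρ *_) (expect-throw-AvoidExcept G width≡ ex recurse) ⟩
  ρ * ((+ 1 / suc k) * ∑ (range a (suc k)) G)
    ≡⟨ cong (λ m → ρ * ((+ 1 / suc k) * ∑ (range a m) G)) k+1≡p+q ⟩
  ρ * ((+ 1 / suc k) * ∑ (range a (p ℕ.+ q)) G)
    ≡⟨ cong (λ z → ρ * ((+ 1 / suc k) * z)) (∑-coverPGF-halves ρ p q a) ⟩
  ρ * ((+ 1 / suc k) * (∑< p (λ l → H l ρ) * H q ρ + H p ρ * ∑< q (λ l → H l ρ)))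
    ≡⟨ H*H-cut-recurrence ρ p q k k+1≡p+q ⟩
  H p ρ * H q ρ ∎
  where
  open ≡-Reasoning
  i = p ℕ.+ a
  b = q ℕ.+ suc i
  width≡ : b ∸ a ≡ suc (suc k)
  width≡ = width-split p q a k+1≡p+q
  G = coverPGF i ρ ∘ coveringHalf i (a , b)
  recurse : ∀ {c r} → a < c → c < b → AvoidExcept i (coveringHalf i (a , b) c) r →
            truncPGF (suc i) ρ N r ≡ G c
  recurse a<c c<b ex' = truncPGF-cover ρ N i ex'
    (coveringHalf-covers (ℕₚ.m≤n+m a p , ℕₚ.m≤n+m (suc i) q) a<c c<b)
    (ℕₚ.≤-pred (ℕₚ.≤-trans (coveringHalf-narrower a<c c<b) bound))

mainTheorem3 : (n j : ℕ) → 1 ≤ n → 1 ≤ j → j ≤ n → (ρ : ℚ) → (N : ℕ) → n ≤ N →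
    truncPGF j ρ N ((0 , n) ∷ []) ≡ H (j ∸ 1) ρ * H (n ∸ j) ρ
mainTheorem3 n (suc i) _ _ i<n ρ N n≤N =
  truncPGF-cover ρ N i (here []) (z≤n , i<n) (ℕₚ.m≤n⇒m≤1+n n≤N)
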